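{- Let $m\ge 2$, $n\ge 3$, let $C$ be any maximal configuration on the $m\times n$ grid, and let $1\le l\le m$ be an integer. If $S=\{1,2,\dots,l\}\times\{1,2,3\}$, then $|C\cap S|\ge \frac{2}{3}|S|=2l$. The same holds for $S=\{1,2,\dots,l\}\times\{n-2,n-1,n\}$.
   Context: The $m\times n$ grid is $[m]\times[n]=\{(i,j):1\le i\le m,\ 1\le j\le n\}$; $(i,j)$ is the lot in row $i$ and column $j$, rows counted from the north (row $1$ northernmost, row $m$ southernmost) and columns from the west (column $1$ westernmost). A configuration is a subset $C\subseteq[m]\times[n]$ (the occupied lots). A house at $(i,j)\in C$ is blocked from sunlight if $(i,j+1)$, $(i,j-1)$, $(i+1,j)$ all lie in the grid and are all occupied (lots outside the grid never obstruct sunlight). A configuration is permissible if no house in it is blocked; it is maximal if it is permissible and no permissible configuration strictly contains it. -}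

module Defs where

open import Data.Nat using (ℕ; zero; suc; _+_; _∸_; _≤_)
open import Data.Bool using (Bool; true; false)
open import Data.Product using (_×_)
open import Relation.Binary.PropositionalEquality using (_≡_)
open import Data.List using (List; filter; length; upTo; map; concatMap)
open import Data.Bool using (T)
open import Relation.Nullary.Decidable using (Dec)
open import Data.Bool.Properties using (T?)
open import Relation.Nullary using (¬_)

-- Lots are (i , j) with 1-based coordinates: row i (1 = northernmost),
-- column j (1 = westernmost).  A configuration on the m×n grid is a
-- Boolean predicate on ℕ × ℕ (true = occupied) that is false outside
-- the grid [m]×[n].

InGrid : ℕ → ℕ → ℕ → ℕ → Set
InGrid m n i j = (1 ≤ i × i ≤ m) × (1 ≤ j × j ≤ n)

Config : Set
Config = ℕ → ℕ → Bool

IsConfig : ℕ → ℕ → Config → Set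
IsConfig m n C = ∀ i j → C i j ≡ true → InGrid m n i j

Occ : ℕ → ℕ → Config → ℕ → ℕ → Set
Occ m n C i j = InGrid m n i j × C i j ≡ true

-- the house at (i , j) is blocked: east, west, south neighbours all lie
-- in the grid and are occupied.  (West neighbour j - 1 needs j ≥ 2.)
Blocked : ℕ → ℕ → Config → ℕ → ℕ → Set
Blocked m n C i j =
  Occ m n C i (suc j) × (2 ≤ j × Occ m n C i (j ∸ 1)) × Occ m n C (suc i) j

Permissible : ℕ → ℕ → Config → Set
Permissible m n C =
  IsConfig m n C × (∀ i j → C i j ≡ true → ¬ Blocked m n C i j)

_⊆C_ : Config → Config → Set
C ⊆C D = ∀ i j → C i j ≡ true → D i j ≡ true

Maximal : ℕ → ℕ → Config → Set
Maximal m n C =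
  Permissible m n C × (∀ D → Permissible m n D → C ⊆C D → D ⊆C C)

block : ℕ → ℕ → List (ℕ × ℕ)
block l a = concatMap (λ i → map (λ k → (suc i , a + k)) (upTo 3)) (upTo l)
  where open import Data.Product using (_,_)

-- |C ∩ S| for S given as a duplicate-free list of lots
count : Config → List (ℕ × ℕ) → ℕ
count C S = length (filter (λ p → T? (C (proj₁ p) (proj₂ p))) S)
  where open import Data.Product using (proj₁; proj₂)

-- In one row of a boundary block, call the lots the edge e, its neighbour c
-- and then f. In a maximal configuration adding a house at an empty lot must
-- block some house, which near the boundary is very restrictive: e or c is
-- occupied and e or f is occupied (insert at e), and if c and f are both
-- empty then the row above is full (insert at c; only the house above c can
-- become blocked).
-- Hence every row of the block holds at least two houses, except rows with
-- a single house, which directly follow a row with three; summing row by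
-- row, each deficit is paid for by the full row before it.
module Submission where

open import Defs
open import Data.Nat using (ℕ; zero; suc; _+_; _*_; _∸_; _≤_; z≤n; s≤s; _≡ᵇ_)
open import Data.Nat.Properties
  using (_≟_; ≡ᵇ⇒≡; ≤-refl; ≤-trans; +-comm; ≤-reflexive; n≤1+n; 1+n≰n; +-identityʳ; +-mono-≤; module ≤-Reasoning)
open import Data.Nat.ListAction using (sum)
open import Data.Nat.ListAction.Properties using (sum-++)
open import Data.Nat.Tactic.RingSolver using (solve-∀)
open import Data.Bool using (Bool; true; false; _∧_; _∨_)
open import Data.Bool.Properties using (∨-zeroʳ; ∧-zeroʳ; not-¬)
open import Data.Unit using (tt)
open import Data.Product using (_×_; _,_; proj₁; proj₂)
open import Data.Sum using (_⊎_; inj₁; inj₂)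
open import Data.Empty using (⊥; ⊥-elim)
open import Data.List using (List; []; _∷_; _++_; map; upTo; applyUpTo; concatMap; filter; length)
open import Data.List.Properties using (length-++; filter-++; map-cong; map-upTo; applyUpTo-∷ʳ)
open import Function using (_∘_)
open import Relation.Nullary using (¬_; yes; no; contradiction)
open import Relation.Binary.PropositionalEquality
  using (_≡_; _≢_; refl; sym; trans; cong; subst; module ≡-Reasoning)

≡ᵇ-refl : ∀ n → (n ≡ᵇ n) ≡ true
≡ᵇ-refl zero    = refl
≡ᵇ-refl (suc n) = ≡ᵇ-refl n

≢⇒≡ᵇ-false : ∀ {m n} → m ≢ n → (m ≡ᵇ n) ≡ false
≢⇒≡ᵇ-false {m} {n} m≢n with m ≡ᵇ n | ≡ᵇ⇒≡ m n
... | false | _    = refl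
... | true  | m≡n = contradiction (m≡n tt) m≢n

insert : Config → ℕ → ℕ → Config
insert C i j x y = ((x ≡ᵇ i) ∧ (y ≡ᵇ j)) ∨ C x y

module _ (C : Config) (i j : ℕ) where

  insert-here : insert C i j i j ≡ true
  insert-here rewrite ≡ᵇ-refl i | ≡ᵇ-refl j = refl

  insert-⊇ : C ⊆C insert C i j
  insert-⊇ x y occ rewrite occ = ∨-zeroʳ _

  insert-elsewhere : ∀ {x y} → x ≢ i ⊎ y ≢ j → insert C i j x y ≡ C x y
  insert-elsewhere (inj₁ x≢i) rewrite ≢⇒≡ᵇ-false x≢i = refl
  insert-elsewhere {x} (inj₂ y≢j) rewrite ≢⇒≡ᵇ-false y≢j | ∧-zeroʳ (x ≡ᵇ i) = refl

  occupied-before-insert : ∀ {x y} → x ≢ i ⊎ y ≢ j → insert C i j x y ≡ true → C x y ≡ true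
  occupied-before-insert ne occ = trans (sym (insert-elsewhere ne)) occ

  occ-insert-elsewhere : ∀ {m n x y} → x ≢ i ⊎ y ≢ j → Occ m n (insert C i j) x y → Occ m n C x y
  occ-insert-elsewhere ne (g , occ) = g , occupied-before-insert ne occ

  blocked-insert-elsewhere : ∀ {m n x y} →
    x ≢ i ⊎ suc y ≢ j → x ≢ i ⊎ y ∸ 1 ≢ j → suc x ≢ i ⊎ y ≢ j →
    Blocked m n (insert C i j) x y → Blocked m n C x y
  blocked-insert-elsewhere neE neW neS (bE , (2≤y , bW) , bS) =
    occ-insert-elsewhere neE bE , (2≤y , occ-insert-elsewhere neW bW) , occ-insert-elsewhere neS bS

  insert-isConfig : ∀ {m n} → IsConfig m n C → InGrid m n i j → IsConfig m n (insert C i j)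
  insert-isConfig isC g x y occ with x ≟ i | y ≟ j
  ... | yes refl | yes refl = g
  ... | no x≢i   | _        = isC x y (occupied-before-insert (inj₁ x≢i) occ)
  ... | yes _    | no y≢j   = isC x y (occupied-before-insert (inj₂ y≢j) occ)

pred-of-2≤ : ∀ {y j} → 2 ≤ y → y ∸ 1 ≡ j → y ≡ suc j
pred-of-2≤ (s≤s _) refl = refl

insert-permissible : ∀ {m n C i j} → Permissible m n C → InGrid m n i j →
  let D = insert C i j in
  ¬ Blocked m n D i j →
  (∀ {y} → suc y ≡ j → C i y ≡ true → ¬ Blocked m n D i y) →
  (C i (suc j) ≡ true → ¬ Blocked m n D i (suc j)) →
  (∀ {x} → suc x ≡ i → C x j ≡ true → ¬ Blocked m n D x j) →
  Permissible m n D
insert-permissible {m} {n} {C} {i} {j} (isC , unblocked) g self west east north =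
  insert-isConfig C i j isC g , unblockedD
  where
  D : Config
  D = insert C i j

  old : ∀ {x y} → x ≢ i ⊎ y ≢ j → D x y ≡ true → C x y ≡ true
  old = occupied-before-insert C i j

  sameRow : ∀ y → D i y ≡ true → ¬ Blocked m n D i y
  sameRow y occ b with y ≟ j | suc y ≟ j | y ∸ 1 ≟ j
  ... | yes refl | _        | _        = self b
  ... | no y≢j   | yes sy≡j | _        = west sy≡j (old (inj₂ y≢j) occ) b
  ... | no y≢j   | no _     | yes py≡j =
    subst (λ y → C i y ≡ true → ¬ Blocked m n D i y)
      (sym (pred-of-2≤ (proj₁ (proj₁ (proj₂ b))) py≡j)) east (old (inj₂ y≢j) occ) b
  ... | no y≢j   | no sy≢j  | no py≢j  =
    unblocked i y (old (inj₂ y≢j) occ)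
      (blocked-insert-elsewhere C i j (inj₂ sy≢j) (inj₂ py≢j) (inj₁ 1+i≢i) b)
    where
    1+i≢i : suc i ≢ i
    1+i≢i e = 1+n≰n (≤-reflexive e)

  otherRow : ∀ {x} y → x ≢ i → D x y ≡ true → ¬ Blocked m n D x y
  otherRow {x} y x≢i occ b with suc x ≟ i | y ≟ j
  ... | yes sx≡i | yes refl = north sx≡i (old (inj₁ x≢i) occ) b
  ... | yes _    | no y≢j   =
    unblocked x y (old (inj₁ x≢i) occ) (blocked-insert-elsewhere C i j (inj₁ x≢i) (inj₁ x≢i) (inj₂ y≢j) b)
  ... | no sx≢i  | _        =
    unblocked x y (old (inj₁ x≢i) occ) (blocked-insert-elsewhere C i j (inj₁ x≢i) (inj₁ x≢i) (inj₁ sx≢i) b)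

  unblockedD : ∀ x y → D x y ≡ true → ¬ Blocked m n D x y
  unblockedD x y with x ≟ i
  ... | yes refl = sameRow y
  ... | no x≢i   = otherRow y x≢i

maximal-gap : ∀ {m n C i j} → Maximal m n C → InGrid m n i j → C i j ≡ false →
  let D = insert C i j in
  ¬ Blocked m n D i j →
  (∀ {y} → suc y ≡ j → C i y ≡ true → ¬ Blocked m n D i y) →
  (C i (suc j) ≡ true → ¬ Blocked m n D i (suc j)) →
  (∀ {x} → suc x ≡ i → C x j ≡ true → ¬ Blocked m n D x j) →
  ⊥
maximal-gap {C = C} {i} {j} (perm , maximal) g free self west east north
  with trans (sym free)
         (maximal (insert C i j) (insert-permissible perm g self west east north)
                  (insert-⊇ C i j) i j (insert-here C i j))
... | ()

row0-empty : ∀ {m n C} → IsConfig m n C → ∀ j → C 0 j ≡ false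
row0-empty {C = C} isC j with C 0 j in occ
... | false = refl
... | true with isC 0 j occ
...   | (() , _) , _

beyond-east : ∀ {m n i} → ¬ InGrid m n i (suc n)
beyond-east (_ , (_ , n<n)) = 1+n≰n n<n

indicator : Bool → ℕ
indicator true  = 1
indicator false = 0

occupied3 : Bool → Bool → Bool → ℕ
occupied3 a b c = indicator a + (indicator b + indicator c)

occupied3-reverse : ∀ a b c → occupied3 a b c ≡ occupied3 c b a
occupied3-reverse a b c = +-reverse (indicator a) (indicator b) (indicator c)
  where
  +-reverse : ∀ x y z → x + (y + z) ≡ z + (y + x)
  +-reverse = solve-∀

tripleCount : Config → ℕ → ℕ → ℕ
tripleCount C r a = occupied3 (C r a) (C r (suc a)) (C r (suc (suc a)))

count-∷ : ∀ C x y ps → count C ((x , y) ∷ ps) ≡ indicator (C x y) + count C ps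
count-∷ C x y ps with C x y
... | true  = refl
... | false = refl

count-++ : ∀ C xs ys → count C (xs ++ ys) ≡ count C xs + count C ys
count-++ C xs ys = trans (cong length (filter-++ _ xs ys)) (length-++ (filter _ xs))

count-concatMap : ∀ C (R : ℕ → List (ℕ × ℕ)) ns → count C (concatMap R ns) ≡ sum (map (count C ∘ R) ns)
count-concatMap C R []       = refl
count-concatMap C R (n ∷ ns) =
  trans (count-++ C (R n) (concatMap R ns)) (cong (count C (R n) +_) (count-concatMap C R ns))

count-row : ∀ C r a → count C (map (λ k → (r , a + k)) (upTo 3)) ≡ tripleCount C r a
count-row C r a = begin
  count C (map (λ k → (r , a + k)) (upTo 3))
    ≡⟨ cong (count C) (map-cong (λ k → cong (r ,_) (+-comm a k)) (upTo 3)) ⟩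
  count C ((r , a) ∷ (r , suc a) ∷ (r , suc (suc a)) ∷ [])
    ≡⟨ count-∷ C r a _ ⟩
  indicator (C r a) + count C ((r , suc a) ∷ (r , suc (suc a)) ∷ [])
    ≡⟨ cong (indicator (C r a) +_) (count-∷ C r (suc a) _) ⟩
  indicator (C r a) + (indicator (C r (suc a)) + count C ((r , suc (suc a)) ∷ []))
    ≡⟨ cong (λ z → indicator (C r a) + (indicator (C r (suc a)) + z))
            (trans (count-∷ C r (suc (suc a)) []) (+-identityʳ _)) ⟩
  tripleCount C r a ∎
  where open ≡-Reasoning

-- h 1 + ⋯ + h l: rows are numbered from 1, row 0 lies outside the grid.
rowSum : (ℕ → ℕ) → ℕ → ℕ
rowSum h l = sum (applyUpTo (h ∘ suc) l)

rowSum-suc : ∀ h l → rowSum h (suc l) ≡ rowSum h l + h (suc l)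
rowSum-suc h l = begin
  sum (applyUpTo (h ∘ suc) (suc l))                 ≡⟨ cong sum (sym (applyUpTo-∷ʳ (h ∘ suc) l)) ⟩
  sum (applyUpTo (h ∘ suc) l ++ h (suc l) ∷ [])     ≡⟨ sum-++ (applyUpTo (h ∘ suc) l) _ ⟩
  rowSum h l + (h (suc l) + 0)                       ≡⟨ cong (rowSum h l +_) (+-identityʳ _) ⟩
  rowSum h l + h (suc l)                             ∎
  where open ≡-Reasoning

count-block : ∀ C l a → count C (block l a) ≡ rowSum (λ r → tripleCount C r a) l
count-block C l a = begin
  count C (block l a)
    ≡⟨ count-concatMap C _ (upTo l) ⟩
  sum (map (λ i → count C (map (λ k → (suc i , a + k)) (upTo 3))) (upTo l))
    ≡⟨ cong sum (map-cong (λ i → count-row C (suc i) a) (upTo l)) ⟩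
  sum (map (λ i → tripleCount C (suc i) a) (upTo l))
    ≡⟨ cong sum (map-upTo _ l) ⟩
  rowSum (λ r → tripleCount C r a) l ∎
  where open ≡-Reasoning

tripleCount-row0 : ∀ {m n C} → IsConfig m n C → ∀ a → tripleCount C 0 a ≡ 0
tripleCount-row0 isC a
  rewrite row0-empty isC a | row0-empty isC (suc a) | row0-empty isC (suc (suc a)) = refl

Compensated : (ℕ → ℕ) → ℕ → Set
Compensated h r = 2 ≤ h (suc r) ⊎ (1 ≤ h (suc r) × h r ≡ 3)

Compensated-resp : ∀ {h h′} → (∀ x → h x ≡ h′ x) → ∀ r → Compensated h r → Compensated h′ r
Compensated-resp h≗h′ r (inj₁ two) = inj₁ (subst (2 ≤_) (h≗h′ (suc r)) two)
Compensated-resp h≗h′ r (inj₂ (one , full)) =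
  inj₂ (subst (1 ≤_) (h≗h′ (suc r)) one , trans (sym (h≗h′ r)) full)

compensated : (e c f : ℕ → Bool) (r : ℕ) →
  (e (suc r) ≡ false → c (suc r) ≡ false → ⊥) →
  (e (suc r) ≡ false → f (suc r) ≡ false → ⊥) →
  (c (suc r) ≡ false → f (suc r) ≡ false → ¬ (e r ≡ true × c r ≡ true × f r ≡ true) → ⊥) →
  Compensated (λ x → occupied3 (e x) (c x) (f x)) r
compensated e c f r e∨c e∨f c∨f∨full
  with e (suc r) | c (suc r) | f (suc r)
... | true  | true  | _     = inj₁ (s≤s (s≤s z≤n))
... | true  | false | true  = inj₁ (s≤s (s≤s z≤n))
... | false | true  | true  = inj₁ (s≤s (s≤s z≤n))
... | false | false | _     = ⊥-elim (e∨c refl refl)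
... | false | true  | false = ⊥-elim (e∨f refl refl)
... | true  | false | false with e r | c r | f r
...   | true  | true  | true  = inj₂ (s≤s z≤n , refl)
...   | false | _     | _     = ⊥-elim (c∨f∨full refl refl λ { (() , _) })
...   | true  | false | _     = ⊥-elim (c∨f∨full refl refl λ { (_ , () , _) })
...   | true  | true  | false = ⊥-elim (c∨f∨full refl refl λ { (_ , _ , ()) })

rowSum-lower-bound : (h : ℕ → ℕ) (L : ℕ) → h 0 ≡ 0 → (∀ r → suc r ≤ L → Compensated h r) →
  ∀ l → l ≤ L → 2 * l ≤ rowSum h l
rowSum-lower-bound h L h0≡0 compensated l l≤L = proj₁ (bound l l≤L)
  where
  open ≤-Reasoning

  2*-suc : ∀ l → 2 * suc l ≡ 2 * l + 2
  2*-suc = solve-∀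
  2*-suc′ : ∀ l → 2 * suc l ≡ suc (2 * l) + 1
  2*-suc′ = solve-∀
  1+2*-suc : ∀ l → suc (2 * suc l) ≡ 2 * l + 3
  1+2*-suc = solve-∀

  -- A full last row leaves one house to spare for a deficient successor.
  bound : ∀ l → l ≤ L → 2 * l ≤ rowSum h l × (h l ≡ 3 → suc (2 * l) ≤ rowSum h l)
  bound zero _ = z≤n , λ h0≡3 → contradiction (trans (sym h0≡0) h0≡3) λ ()
  bound (suc l) sl≤L rewrite rowSum-suc h l = atLeast (compensated l sl≤L) , spare
    where
    ih : 2 * l ≤ rowSum h l × (h l ≡ 3 → suc (2 * l) ≤ rowSum h l)
    ih = bound l (≤-trans (n≤1+n l) sl≤L)

    atLeast : Compensated h l → 2 * suc l ≤ rowSum h l + h (suc l)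
    atLeast (inj₁ two) = begin
      2 * suc l              ≡⟨ 2*-suc l ⟩
      2 * l + 2              ≤⟨ +-mono-≤ (proj₁ ih) two ⟩
      rowSum h l + h (suc l) ∎
    atLeast (inj₂ (one , full)) = begin
      2 * suc l              ≡⟨ 2*-suc′ l ⟩
      suc (2 * l) + 1        ≤⟨ +-mono-≤ (proj₂ ih full) one ⟩
      rowSum h l + h (suc l) ∎

    spare : h (suc l) ≡ 3 → suc (2 * suc l) ≤ rowSum h l + h (suc l)
    spare full = begin
      suc (2 * suc l)        ≡⟨ 1+2*-suc l ⟩
      2 * l + 3              ≤⟨ +-mono-≤ (proj₁ ih) (≤-reflexive (sym full)) ⟩
      rowSum h l + h (suc l) ∎

block-lower-bound : ∀ {m n C} → Maximal m n C → ∀ a →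
  (∀ r → suc r ≤ m → Compensated (λ x → tripleCount C x a) r) →
  ∀ l → l ≤ m → 2 * l ≤ count C (block l a)
block-lower-bound {m} {C = C} M a compensatedRows l l≤m =
  subst (2 * l ≤_) (sym (count-block C l a))
    (rowSum-lower-bound _ m (tripleCount-row0 (proj₁ (proj₁ M)) a) compensatedRows l l≤m)

west-compensated : ∀ {m n C} → Maximal m n C → 2 ≤ n →
  ∀ r → suc r ≤ m → Compensated (λ x → tripleCount C x 1) r
west-compensated {m} {n} {C} M 2≤n r r<m =
  compensated (λ x → C x 1) (λ x → C x 2) (λ x → C x 3) r edge-or-middle edge-or-far middle-or-far
  where
  beforeEdge : ∀ {x y} → x ≢ suc r ⊎ y ≢ 1 → insert C (suc r) 1 x y ≡ true → C x y ≡ true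
  beforeEdge = occupied-before-insert C (suc r) 1

  beforeMiddle : ∀ {x y} → x ≢ suc r ⊎ y ≢ 2 → insert C (suc r) 2 x y ≡ true → C x y ≡ true
  beforeMiddle = occupied-before-insert C (suc r) 2

  edge-or-middle : C (suc r) 1 ≡ false → C (suc r) 2 ≡ false → ⊥
  edge-or-middle free₁ free₂ = maximal-gap M ((s≤s z≤n , r<m) , (≤-refl , ≤-trans (n≤1+n 1) 2≤n)) free₁
    (λ { (_ , (s≤s () , _) , _) })
    (λ { refl _ (_ , (() , _) , _) })
    (λ occ₂ _ → not-¬ occ₂ free₂)
    (λ { _ _ (_ , (s≤s () , _) , _) })

  edge-or-far : C (suc r) 1 ≡ false → C (suc r) 3 ≡ false → ⊥
  edge-or-far free₁ free₃ = maximal-gap M ((s≤s z≤n , r<m) , (≤-refl , ≤-trans (n≤1+n 1) 2≤n)) free₁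
    (λ { (_ , (s≤s () , _) , _) })
    (λ { refl _ (_ , (() , _) , _) })
    (λ { _ ((_ , occ₃) , _) → not-¬ (beforeEdge (inj₂ λ ()) occ₃) free₃ })
    (λ { _ _ (_ , (s≤s () , _) , _) })

  middle-or-far : C (suc r) 2 ≡ false → C (suc r) 3 ≡ false →
    ¬ (C r 1 ≡ true × C r 2 ≡ true × C r 3 ≡ true) → ⊥
  middle-or-far free₂ free₃ notFull = maximal-gap M ((s≤s z≤n , r<m) , (s≤s z≤n , 2≤n)) free₂
    (λ { ((_ , occ₃) , _) → not-¬ (beforeMiddle (inj₂ λ ()) occ₃) free₃ })
    (λ { refl _ (_ , (s≤s () , _) , _) })
    (λ occ₃ _ → not-¬ occ₃ free₃)
    (λ { refl occ₂ ((_ , occ₃) , (_ , (_ , occ₁)) , _) →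
         notFull (beforeMiddle (inj₁ λ ()) occ₁ , occ₂ , beforeMiddle (inj₁ λ ()) occ₃) })

east-compensated : ∀ {m a C} → Maximal m (suc (suc a)) C →
  ∀ r → suc r ≤ m → Compensated (λ x → tripleCount C x a) r
east-compensated {m} {a} {C} M r r<m =
  Compensated-resp (λ x → occupied3-reverse (C x (suc (suc a))) (C x (suc a)) (C x a)) r
    (compensated (λ x → C x (suc (suc a))) (λ x → C x (suc a)) (λ x → C x a) r
       edge-or-middle edge-or-far middle-or-far)
  where
  beforeEdge : ∀ {x y} → x ≢ suc r ⊎ y ≢ suc (suc a) →
    insert C (suc r) (suc (suc a)) x y ≡ true → C x y ≡ true
  beforeEdge = occupied-before-insert C (suc r) (suc (suc a))

  beforeMiddle : ∀ {x y} → x ≢ suc r ⊎ y ≢ suc a → insert C (suc r) (suc a) x y ≡ true → C x y ≡ true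
  beforeMiddle = occupied-before-insert C (suc r) (suc a)

  outside : ∀ {x} → C x (suc (suc (suc a))) ≡ true → ⊥
  outside occ = beyond-east (proj₁ (proj₁ M) _ _ occ)

  edge-or-middle : C (suc r) (suc (suc a)) ≡ false → C (suc r) (suc a) ≡ false → ⊥
  edge-or-middle freeE freeM = maximal-gap M ((s≤s z≤n , r<m) , (s≤s z≤n , ≤-refl)) freeE
    (λ b → beyond-east (proj₁ (proj₁ b)))
    (λ { refl occM _ → not-¬ occM freeM })
    (λ occ _ → outside occ)
    (λ _ _ b → beyond-east (proj₁ (proj₁ b)))

  edge-or-far : C (suc r) (suc (suc a)) ≡ false → C (suc r) a ≡ false → ⊥
  edge-or-far freeE freeF = maximal-gap M ((s≤s z≤n , r<m) , (s≤s z≤n , ≤-refl)) freeE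
    (λ b → beyond-east (proj₁ (proj₁ b)))
    (λ { refl _ (_ , (_ , (_ , occF)) , _) → not-¬ (beforeEdge (inj₂ λ ()) occF) freeF })
    (λ occ _ → outside occ)
    (λ _ _ b → beyond-east (proj₁ (proj₁ b)))

  middle-or-far : C (suc r) (suc a) ≡ false → C (suc r) a ≡ false →
    ¬ (C r (suc (suc a)) ≡ true × C r (suc a) ≡ true × C r a ≡ true) → ⊥
  middle-or-far freeM freeF notFull = maximal-gap M ((s≤s z≤n , r<m) , (s≤s z≤n , n≤1+n _)) freeM
    (λ { (_ , (_ , (_ , occF)) , _) → not-¬ (beforeMiddle (inj₂ λ ()) occF) freeF })
    (λ { refl occF _ → not-¬ occF freeF })
    (λ _ b → beyond-east (proj₁ (proj₁ b)))
    (λ { refl occM ((_ , occE) , (_ , (_ , occF)) , _) →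
         notFull (beforeMiddle (inj₁ λ ()) occE , occM , beforeMiddle (inj₁ λ ()) occF) })

lemma4p3 : (m n : ℕ) → 2 ≤ m → 3 ≤ n → (C : Config) → Maximal m n C →
    (l : ℕ) → 1 ≤ l → l ≤ m →
    (2 * l ≤ count C (block l 1)) × (2 * l ≤ count C (block l (n ∸ 2)))
lemma4p3 m .(suc (suc (suc k))) _ (s≤s (s≤s (s≤s {n = k} _))) C M l _ l≤m =
  block-lower-bound M 1 (west-compensated M (s≤s (s≤s z≤n))) l l≤m ,
  block-lower-bound M (suc k) (east-compensated M) l l≤m
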